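{- Let $(a,b)\in\mathcal{B}$ with $b$ even, $a\ge 1$, $a+b\ge 1$ and $b\ne 0$. Then $U=\{(a,b)\}$ is unavoidable in $\mathcal{B}$.
   Context: The bicyclic inverse semigroup is $\mathcal{B}=\{(a,b)\in\mathbb{Z}\times\mathbb{Z}\mid a\ge 0,\ a+b\ge 0\}$ with multiplication $(a,b)(c,d)=(\max\{c+d,a\}-d,\ b+d)$. A subset $U\subseteq\mathcal{B}$ is avoidable if $\mathcal{B}$ can be partitioned into two sets $A$ and $B$ such that no element of $U$ is a product $st$ of two distinct elements $s\ne t$ both in $A$ or both in $B$; otherwise $U$ is unavoidable. -}

module Defs where

open import Data.Integer using (ℤ; +_; _+_; _-_; _≤_; _⊔_)
open import Data.Bool using (Bool)
open import Data.Product using (Σ; _×_; _,_; proj₁; proj₂; ∃)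
open import Relation.Binary.PropositionalEquality using (_≡_)
open import Relation.Nullary using (¬_)

record 𝓑 : Set where
  constructor ⟨_,_∣_,_⟩
  field
    fst  : ℤ
    snd  : ℤ
    fst≥0 : + 0 ≤ fst
    sum≥0 : + 0 ≤ fst + snd
open 𝓑 public

pair : 𝓑 → ℤ × ℤ
pair x = fst x , snd x

mulℤ : ℤ × ℤ → ℤ × ℤ → ℤ × ℤ
mulℤ (a , b) (c , d) = ((c + d) ⊔ a) - d , b + d

-- a subset U of 𝓑 (given as a predicate on 𝓑) is avoidable if there is a
-- partition of 𝓑 into two sets A (colour true) and B (colour false) such that
-- no element of U is the product s t of distinct s ≠ t of the same class
Avoidable : (𝓑 → Set) → Set
Avoidable U = Σ (𝓑 → Bool) λ colour →
  ∀ (u s t : 𝓑) → U u → ¬ (pair s ≡ pair t) → colour s ≡ colour t →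
    ¬ (mulℤ (pair s) (pair t) ≡ pair u)

Unavoidable : (𝓑 → Set) → Set
Unavoidable U = ¬ Avoidable U

Singleton : ℤ → ℤ → 𝓑 → Set
Singleton a b x = pair x ≡ (a , b)

-- Write b = 2h.  Elements with the same second coordinate h multiply as
--   (c , h) (d , h) = (max (c - h) d , 2h),
-- so (a , 2h) is the product x y of two such elements whenever the first
-- coordinates satisfy "c - h ≤ d = a" or "d ≤ c - h = a".  Take
--   P = (a , h),   Q = (a + h , h),   R = (r , h)  with r < min (a , a + h);
-- then Q P = R P = Q R = (a , 2h), and P, Q, R are pairwise distinct because
-- h ≠ 0 and r lies strictly below a and a + h.  In any 2-colouring two of
-- P, Q, R share a colour (pigeonhole), and their product hits (a , 2h).
module Submission where

open import Defs
open import Data.Integer using (ℤ; +_; _+_; _≤_)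
open import Data.Integer.Divisibility using (_∣_)
open import Relation.Binary.PropositionalEquality using (_≢_)

open import Data.Integer.Base using (_-_; _*_; _<_; _⊓_; pred; 0ℤ)
open import Data.Integer.Properties
  using ( ≤-refl; ≤-trans; ≤-total; <⇒≤; <⇒≢; i≤j⇒i⊔j≡j; i≥j⇒i⊔j≡i; +-monoˡ-≤; +-monoʳ-≤
        ; +-identityʳ; +-inverseʳ; +-assoc; i⊓j≤i; i⊓j≤j; ⊓-glb; mono-≤-distrib-⊓
        ; pred-mono; pred-+; i≤pred[j]⇒i<j; i<j⇒i≤pred[j]; suc[i]≤j⇒i<j
        ; module ≤-Reasoning)
open import Data.Integer.Divisibility.Signed using (divides; ∣ᵤ⇒∣)
open import Data.Integer.Tactic.RingSolver using (solve-∀)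
open import Data.Bool using (Bool; true; false)
open import Data.Product using (_,_; proj₁)
open import Data.Sum using (_⊎_; inj₁; inj₂)
open import Relation.Binary.PropositionalEquality
  using (_≡_; refl; sym; trans; cong; cong₂; subst; module ≡-Reasoning)

pigeonhole : (x y z : Bool) → x ≡ y ⊎ x ≡ z ⊎ y ≡ z
pigeonhole true  true  _     = inj₁ refl
pigeonhole false false _     = inj₁ refl
pigeonhole true  false true  = inj₂ (inj₁ refl)
pigeonhole false true  false = inj₂ (inj₁ refl)
pigeonhole true  false false = inj₂ (inj₂ refl)
pigeonhole false true  true  = inj₂ (inj₂ refl)

triangle⇒unavoidable : (U : 𝓑 → Set) (u p q r : 𝓑) → U u →
  pair q ≢ pair p → pair r ≢ pair p → pair q ≢ pair r →
  mulℤ (pair q) (pair p) ≡ pair u → mulℤ (pair r) (pair p) ≡ pair u →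
  mulℤ (pair q) (pair r) ≡ pair u → Unavoidable U
triangle⇒unavoidable U u p q r u∈U q≢p r≢p q≢r qp≡u rp≡u qr≡u (colour , avoids)
  with pigeonhole (colour q) (colour r) (colour p)
... | inj₁ q~r        = avoids u q r u∈U q≢r q~r qr≡u
... | inj₂ (inj₁ q~p) = avoids u q p u∈U q≢p q~p qp≡u
... | inj₂ (inj₂ r~p) = avoids u r p u∈U r≢p r~p rp≡u

x+y-y≡x : ∀ x y → (x + y) - y ≡ x
x+y-y≡x = solve-∀

mul-sameShift-right : ∀ {c d h} → c ≤ d + h → mulℤ (c , h) (d , h) ≡ (d , h + h)
mul-sameShift-right {c} {d} {h} c≤d+h =
  cong₂ _,_ (trans (cong (_- h) (i≥j⇒i⊔j≡i c≤d+h)) (x+y-y≡x d h)) refl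

mul-sameShift-left : ∀ {e d h} → d ≤ e → mulℤ (e + h , h) (d , h) ≡ (e , h + h)
mul-sameShift-left {e} {d} {h} d≤e =
  cong₂ _,_ (trans (cong (_- h) (i≤j⇒i⊔j≡j (+-monoˡ-≤ h d≤e))) (x+y-y≡x e h)) refl

min≤midpoint : ∀ a h → a ⊓ ((a + h) + h) ≤ a + h
min≤midpoint a h with ≤-total 0ℤ h
... | inj₁ 0≤h = ≤-trans (i⊓j≤i a _) (begin
  a         ≡⟨ sym (+-identityʳ a) ⟩
  a + 0ℤ    ≤⟨ +-monoʳ-≤ a 0≤h ⟩
  a + h     ∎)
  where open ≤-Reasoning
... | inj₂ h≤0 = ≤-trans (i⊓j≤j a _) (begin
  (a + h) + h   ≤⟨ +-monoʳ-≤ (a + h) h≤0 ⟩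
  (a + h) + 0ℤ  ≡⟨ +-identityʳ (a + h) ⟩
  a + h         ∎)
  where open ≤-Reasoning

0≤pred : ∀ {x} → + 1 ≤ x → + 0 ≤ pred x
0≤pred 1≤x = i<j⇒i≤pred[j] (suc[i]≤j⇒i<j 1≤x)

1≤⇒0≤ : ∀ {x} → + 1 ≤ x → + 0 ≤ x
1≤⇒0≤ 1≤x = <⇒≤ (suc[i]≤j⇒i<j 1≤x)

pred<bound : ∀ {x y} → x ≤ y → pred x < y
pred<bound x≤y = i≤pred[j]⇒i<j (pred-mono x≤y)

x+y-x≡y : ∀ x y → (x + y) - x ≡ y
x+y-x≡y = solve-∀

shift≢ : ∀ a {h} → h ≢ 0ℤ → a + h ≢ a
shift≢ a {h} h≢0 a+h≡a = h≢0 (begin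
  h             ≡⟨ sym (x+y-x≡y a h) ⟩
  (a + h) - a   ≡⟨ cong (_- a) a+h≡a ⟩
  a - a         ≡⟨ +-inverseʳ a ⟩
  0ℤ            ∎)
  where open ≡-Reasoning

doubleShift-unavoidable : ∀ a h → h ≢ 0ℤ → + 1 ≤ a → + 1 ≤ a + (h + h) →
  Unavoidable (Singleton a (h + h))
doubleShift-unavoidable a h h≢0 1≤a 1≤a+2h =
  triangle⇒unavoidable (Singleton a (h + h)) U P Q R refl
    (λ e → shift≢ a h≢0 (cong proj₁ e))
    (λ e → <⇒≢ r<a (cong proj₁ e))
    (λ e → <⇒≢ r<a+h (sym (cong proj₁ e)))
    (mul-sameShift-right ≤-refl)
    (mul-sameShift-right (<⇒≤ r<a+h))
    (mul-sameShift-left (<⇒≤ r<a))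
  where
  1≤a+h+h : + 1 ≤ (a + h) + h
  1≤a+h+h = subst (+ 1 ≤_) (sym (+-assoc a h h)) 1≤a+2h
  1≤a+h : + 1 ≤ a + h
  1≤a+h = ≤-trans (⊓-glb 1≤a 1≤a+h+h) (min≤midpoint a h)
  m r : ℤ
  m = a ⊓ (a + h)
  r = pred m
  r<a : r < a
  r<a = pred<bound (i⊓j≤i a (a + h))
  r<a+h : r < a + h
  r<a+h = pred<bound (i⊓j≤j a (a + h))
  -- m + h = min (a + h) (a + 2h) ≥ 1, hence r + h = pred (m + h) ≥ 0
  0≤r+h : + 0 ≤ r + h
  0≤r+h = subst (+ 0 ≤_) (sym (pred-+ m h)) (0≤pred (subst (+ 1 ≤_)
    (sym (mono-≤-distrib-⊓ (+-monoˡ-≤ h) a (a + h))) (⊓-glb 1≤a+h 1≤a+h+h)))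
  P Q R U : 𝓑
  P = ⟨ a , h ∣ 1≤⇒0≤ 1≤a , 1≤⇒0≤ 1≤a+h ⟩
  Q = ⟨ a + h , h ∣ 1≤⇒0≤ 1≤a+h , 1≤⇒0≤ 1≤a+h+h ⟩
  R = ⟨ r , h ∣ 0≤pred (⊓-glb 1≤a 1≤a+h) , 0≤r+h ⟩
  U = ⟨ a , h + h ∣ 1≤⇒0≤ 1≤a , 1≤⇒0≤ 1≤a+2h ⟩

h*2≡h+h : ∀ h → h * + 2 ≡ h + h
h*2≡h+h = solve-∀

mainTheorem2 : (a b : ℤ) → (+ 0 ≤ a) → (+ 0 ≤ a + b) → (+ 2 ∣ b) →
    (+ 1 ≤ a) → (+ 1 ≤ a + b) → b ≢ + 0 → Unavoidable (Singleton a b)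
mainTheorem2 a b _ _ 2∣b 1≤a 1≤a+b b≢0 with ∣ᵤ⇒∣ 2∣b
... | divides h b≡h*2 =
  subst (λ c → Unavoidable (Singleton a c)) (sym b≡h+h)
    (doubleShift-unavoidable a h h≢0 1≤a (subst (λ c → + 1 ≤ a + c) b≡h+h 1≤a+b))
  where
  b≡h+h : b ≡ h + h
  b≡h+h = trans b≡h*2 (h*2≡h+h h)
  h≢0 : h ≢ 0ℤ
  h≢0 h≡0 = b≢0 (trans b≡h*2 (cong (_* + 2) h≡0))
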